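{- Let $I\subseteq\omega$ be the least set satisfying, for all $a\in\omega$, \[ a\in I \iff (\exists e)[a=\langle 0,e\rangle] \ \vee\ (\exists e)[a=\langle 1,e\rangle \ \&\ (\forall k)[\varphi_e(k)\in I]], \] and let $\mathrm{Hp}\subseteq\omega\times\omega$ be the least set satisfying, for all $a,x\in\omega$, \[ (a,x)\in\mathrm{Hp} \iff (\exists e)[a=\langle 0,e\rangle \ \&\ x=e] \ \vee\ (\exists e)[a=\langle 1,e\rangle \ \&\ (\exists t)(\forall s)[(\varphi_e(\langle t,s\rangle),x)\in\mathrm{Hp}]]. \] Let $\psi(y,\tilde R)$ be the formula \[ \psi(y,\tilde{R}) \equiv (\exists a,x,e)\big\{y = \langle a,x\rangle \ \&\ \big( [a = \langle 0,e\rangle \ \&\ x = e] \ \vee\ [a = \langle 1,e\rangle \ \&\ (\exists t)(\forall s)[\langle \varphi_e(\langle t,s\rangle),x\rangle \in \tilde{R}]]\big)\big\}. \] If $Q\subseteq\omega$ is a fixed point of $\psi$ (i.e., $y\in Q\iff\psi(y,Q)$ for all $y\in\omega$), then for all $a\in I$ and all $x\in\omega$, \[ (a,x)\in\mathrm{Hp} \iff \langle a,x\rangle\in Q. \]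
   Context: $\varphi_e$ denotes the $e$-th partial recursive function from $\omega$ to $\omega$; "$\varphi_e(k)\in A$" means $\varphi_e$ is defined at $k$ with value in $A$. $\langle\cdot\rangle$ is a fixed recursive injection from $\omega^{<\omega}$ to $\omega$; $(a,x)$ denotes an ordinary ordered pair in $\omega\times\omega$. The least sets $I$ and $\mathrm{Hp}$ exist since the defining operators are monotone. -}

module Defs where

open import Data.Nat using (ℕ; zero; suc; _+_)
open import Data.List using (List; []; _∷_)
open import Data.Maybe using (Maybe; just; nothing)
open import Data.Product using (_×_; _,_; Σ; ∃; ∃-syntax)
open import Data.Sum using (_⊎_)
open import Relation.Binary.PropositionalEquality using (_≡_)

tri : ℕ → ℕ
tri zero    = 0
tri (suc n) = suc n + tri n

-- Cantor pairing ω×ω → ω (a recursive bijection)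
pair : ℕ → ℕ → ℕ
pair x y = tri (x + y) + y

-- its inverse, computed by walking the Cantor enumeration n times
unpair : ℕ → ℕ × ℕ
unpair zero = 0 , 0
unpair (suc n) with unpair n
... | zero  , y = suc y , 0
... | suc x , y = x , suc y

⟪_⟫ : List ℕ → ℕ
⟪ [] ⟫     = 0
⟪ x ∷ xs ⟫ = suc (pair x ⟪ xs ⟫)

⟨_,_⟩ : ℕ → ℕ → ℕ
⟨ a , b ⟩ = ⟪ a ∷ b ∷ [] ⟫

-- Partial recursive functions: a standard acceptable numbering via
-- μ-recursive function codes, evaluated with a fuel (step) bound.
--
-- A code c is read via  unpair c = (tag , r):
--   tag 0 : zero function          tag 1 : successor of first argument
--   tag 2 : projection onto the r-th argument
--   tag 3 : composition, unpair r = (f , gs), gs a ⟪⟫-code of a list of codes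
--   tag 4 : primitive recursion, unpair r = (f , g)
--   tag ≥5: minimisation μ of the function coded by r

hd : List ℕ → ℕ
hd []      = 0
hd (x ∷ _) = x

nth : ℕ → List ℕ → ℕ
nth _       []       = 0
nth zero    (x ∷ _)  = x
nth (suc i) (_ ∷ xs) = nth i xs

tl : List ℕ → List ℕ
tl []       = []
tl (_ ∷ xs) = xs

mutual
  eval : ℕ → ℕ → List ℕ → Maybe ℕ
  eval zero    c args = nothing
  eval (suc n) c args = evalTag n (Data.Product.proj₁ (unpair c)) (Data.Product.proj₂ (unpair c)) args

  evalTag : ℕ → ℕ → ℕ → List ℕ → Maybe ℕ
  evalTag n 0 r args = just 0
  evalTag n 1 r args = just (suc (hd args))
  evalTag n 2 r args = just (nth r args)
  evalTag n 3 r args with evalList n (Data.Product.proj₂ (unpair r)) args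
  ... | nothing = nothing
  ... | just vs = eval n (Data.Product.proj₁ (unpair r)) vs
  evalTag n 4 r args =
    primRec n (Data.Product.proj₁ (unpair r)) (Data.Product.proj₂ (unpair r)) (hd args) (tl args)
  evalTag n (suc (suc (suc (suc (suc _))))) r args = search n r 0 args

  evalList : ℕ → ℕ → List ℕ → Maybe (List ℕ)
  evalList zero    _       args = nothing
  evalList (suc n) zero    args = just []
  evalList (suc n) (suc m) args with eval n (Data.Product.proj₁ (unpair m)) args
  ... | nothing = nothing
  ... | just v with evalList n (Data.Product.proj₂ (unpair m)) args
  ...   | nothing = nothing
  ...   | just vs = just (v ∷ vs)

  primRec : ℕ → ℕ → ℕ → ℕ → List ℕ → Maybe ℕ
  primRec n f g zero    rest = eval n f rest
  primRec n f g (suc x) rest with primRec n f g x rest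
  ... | nothing = nothing
  ... | just v  = eval n g (x ∷ v ∷ rest)

  search : ℕ → ℕ → ℕ → List ℕ → Maybe ℕ
  search zero    f i args = nothing
  search (suc n) f i args with eval n f (i ∷ args)
  ... | nothing       = nothing
  ... | just zero     = just i
  ... | just (suc _)  = search n f (suc i) args

_·_↓=_ : ℕ → ℕ → ℕ → Set
e · k ↓= y = ∃[ n ] eval n e (k ∷ []) ≡ just y

φ[_]_∈_ : ℕ → ℕ → (ℕ → Set) → Set
φ[ e ] k ∈ A = ∃[ y ] (e · k ↓= y × A y)

data I : ℕ → Set where
  I-0 : ∀ e → I ⟨ 0 , e ⟩
  I-1 : ∀ e → (∀ k → φ[ e ] k ∈ I) → I ⟨ 1 , e ⟩

data Hp : ℕ → ℕ → Set where
  Hp-0 : ∀ e → Hp ⟨ 0 , e ⟩ e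
  Hp-1 : ∀ e x → (∃[ t ] ∀ s → φ[ e ] ⟨ t , s ⟩ ∈ (λ v → Hp v x)) → Hp ⟨ 1 , e ⟩ x

ψ : ℕ → (ℕ → Set) → Set
ψ y R = ∃[ a ] ∃[ x ] ∃[ e ]
  ( y ≡ ⟨ a , x ⟩
  × ( (a ≡ ⟨ 0 , e ⟩ × x ≡ e)
    ⊎ (a ≡ ⟨ 1 , e ⟩ × ∃[ t ] ∀ s → φ[ e ] ⟨ t , s ⟩ ∈ (λ v → R ⟨ v , x ⟩))))

IsFixedPointψ : (ℕ → Set) → Set
IsFixedPointψ Q = ∀ y → (Q y → ψ y Q) × (ψ y Q → Q y)

module Submission where

-- Both directions use only the shape of ψ, which mirrors the
-- clauses defining Hp, and two facts about the coding machinery: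
--   (1) the pairing ⟨_,_⟩ is injective, so a code ⟨ ⟨ i , e ⟩ , x ⟩
--       determines i, e and x, and ψ can be inverted on such codes;
--   (2) partial recursive functions are single-valued: if φ_e(k) ↓= y and
--       φ_e(k) ↓= y' then y ≡ y' (evaluation is monotone in its fuel).
-- Hp ⊆ Q holds for every ψ-closed Q (ψ y Q → Q y), by induction on Hp.
-- Conversely, for every Q with Q y → ψ y Q we show by induction on a ∈ I
-- that Q ⟨ a , x ⟩ → Hp a x: for a = ⟨ 1 , e ⟩ the witness t from ψ works,
-- since by (2) the value φ_e(⟨ t , s ⟩) lying in I (the induction
-- hypothesis) is the value v with Q ⟨ v , x ⟩.  This is where a ∈ I is
-- needed.  A fixed point of ψ has both properties, giving lemma14.

open import Defs
open import Data.Nat using (ℕ; zero; suc; _+_; _≤_; _<_; s≤s; z≤n)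
open import Data.Nat.Properties
open import Data.Product using (_×_; _,_; proj₁; proj₂; ∃-syntax)
open import Data.Sum using (inj₁; inj₂)
open import Data.Maybe using (just; nothing)
open import Data.Maybe.Properties using (just-injective)
open import Data.List using (_∷_)
open import Data.Empty using (⊥-elim)
open import Relation.Binary.PropositionalEquality
open import Relation.Binary using (tri<; tri≈; tri>)

tri-mono : ∀ {m n} → m ≤ n → tri m ≤ tri n
tri-mono {zero}  {n}     _       = z≤n
tri-mono {suc m} {suc n} (s≤s p) = +-mono-≤ (s≤s p) (tri-mono p)

pair<tri-suc : ∀ x y → pair x y < tri (suc (x + y))
pair<tri-suc x y = begin-strict
    tri (x + y) + y        ≤⟨ +-monoʳ-≤ (tri (x + y)) (m≤n+m y x) ⟩
    tri (x + y) + (x + y)  ≡⟨ +-comm (tri (x + y)) (x + y) ⟩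
    (x + y) + tri (x + y)  <⟨ n<1+n _ ⟩
    tri (suc (x + y))      ∎
  where open ≤-Reasoning

pair-diagonal : ∀ x y x' y' → x + y < x' + y' → pair x y < pair x' y'
pair-diagonal x y x' y' lt = begin-strict
    pair x y           <⟨ pair<tri-suc x y ⟩
    tri (suc (x + y))  ≤⟨ tri-mono lt ⟩
    tri (x' + y')      ≤⟨ m≤m+n _ y' ⟩
    pair x' y'         ∎
  where open ≤-Reasoning

pair-injective : ∀ x y x' y' → pair x y ≡ pair x' y' → x ≡ x' × y ≡ y'
pair-injective x y x' y' eq with <-cmp (x + y) (x' + y')
... | tri< lt _ _  = ⊥-elim (<-irrefl eq (pair-diagonal x y x' y' lt))
... | tri> _ _ gt  = ⊥-elim (<-irrefl (sym eq) (pair-diagonal x' y' x y gt))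
... | tri≈ _ sum _ = x≡x' , y≡y'
  where
    y≡y' : y ≡ y'
    y≡y' = +-cancelˡ-≡ (tri (x + y)) y y' (trans eq (cong (λ z → tri z + y') (sym sum)))
    x≡x' : x ≡ x'
    x≡x' = +-cancelʳ-≡ y x x' (trans sum (cong (x' +_) (sym y≡y')))

code-injective : ∀ a b a' b' → ⟨ a , b ⟩ ≡ ⟨ a' , b' ⟩ → a ≡ a' × b ≡ b'
code-injective a b a' b' eq with pair-injective a _ a' _ (suc-injective eq)
... | a≡a' , rest = a≡a' , proj₁ (pair-injective b 0 b' 0 (suc-injective rest))

mutual
  eval-step : ∀ n c args {v} → eval n c args ≡ just v → eval (suc n) c args ≡ just v
  eval-step zero    c args ()
  eval-step (suc n) c args eq = evalTag-step n (proj₁ (unpair c)) (proj₂ (unpair c)) args eq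

  evalTag-step : ∀ n t r args {v} → evalTag n t r args ≡ just v → evalTag (suc n) t r args ≡ just v
  evalTag-step n 0 r args eq = eq
  evalTag-step n 1 r args eq = eq
  evalTag-step n 2 r args eq = eq
  evalTag-step n 3 r args eq with evalList n (proj₂ (unpair r)) args in list≡
  evalTag-step n 3 r args () | nothing
  ... | just vs rewrite evalList-step n (proj₂ (unpair r)) args list≡ = eval-step n _ vs eq
  evalTag-step n 4 r args eq = primRec-step n (proj₁ (unpair r)) (proj₂ (unpair r)) (hd args) (tl args) eq
  evalTag-step n (suc (suc (suc (suc (suc _))))) r args eq = search-step n r 0 args eq

  evalList-step : ∀ n m args {vs} → evalList n m args ≡ just vs → evalList (suc n) m args ≡ just vs
  evalList-step zero    m       args ()
  evalList-step (suc n) zero    args eq = eq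
  evalList-step (suc n) (suc m) args eq with eval n (proj₁ (unpair m)) args in head≡
  evalList-step (suc n) (suc m) args () | nothing
  ... | just v with evalList n (proj₂ (unpair m)) args in tail≡
  evalList-step (suc n) (suc m) args () | just v | nothing
  ... | just ws rewrite eval-step n _ args head≡ | evalList-step n _ args tail≡ = eq

  primRec-step : ∀ n f g x rest {v} → primRec n f g x rest ≡ just v → primRec (suc n) f g x rest ≡ just v
  primRec-step n f g zero    rest eq = eval-step n f rest eq
  primRec-step n f g (suc x) rest eq with primRec n f g x rest in prev≡
  primRec-step n f g (suc x) rest () | nothing
  ... | just w rewrite primRec-step n f g x rest prev≡ = eval-step n g _ eq

  search-step : ∀ n f i args {v} → search n f i args ≡ just v → search (suc n) f i args ≡ just v
  search-step zero    f i args ()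
  search-step (suc n) f i args eq with eval n f (i ∷ args) in test≡
  search-step (suc n) f i args () | nothing
  ... | just zero    rewrite eval-step n f _ test≡ = eq
  ... | just (suc _) rewrite eval-step n f _ test≡ = search-step n f (suc i) args eq

eval-mono : ∀ {n m} c args {v} → n ≤ m → eval n c args ≡ just v → eval m c args ≡ just v
eval-mono c args n≤m eq with m≤n⇒m<n∨m≡n n≤m
... | inj₂ refl      = eq
... | inj₁ (s≤s n<m) = eval-step _ c args (eval-mono c args n<m eq)

↓=-functional : ∀ {e k y y'} → e · k ↓= y → e · k ↓= y' → y ≡ y'
↓=-functional {e} (n , p) (m , q) with ≤-total n m
... | inj₁ n≤m = just-injective (trans (sym (eval-mono e _ n≤m p)) q)
... | inj₂ m≤n = just-injective (trans (sym p) (eval-mono e _ m≤n q))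

φ-meet : ∀ {e k} {A B : ℕ → Set} → φ[ e ] k ∈ A → φ[ e ] k ∈ B → φ[ e ] k ∈ (λ v → A v × B v)
φ-meet {B = B} (y , y↓ , Ay) (y' , y'↓ , By') =
  y , y↓ , Ay , subst B (sym (↓=-functional y↓ y'↓)) By'

φ-map : ∀ {e k} {A B : ℕ → Set} → (∀ {v} → A v → B v) → φ[ e ] k ∈ A → φ[ e ] k ∈ B
φ-map f (y , y↓ , Ay) = y , y↓ , f Ay

I-induction : (P : ℕ → Set) →
              (∀ e → P ⟨ 0 , e ⟩) →
              (∀ e → (∀ k → φ[ e ] k ∈ P) → P ⟨ 1 , e ⟩) →
              ∀ {a} → I a → P a
I-induction P base step (I-0 e)   = base e
I-induction P base step (I-1 e g) =
  step e λ k → proj₁ (g k) , proj₁ (proj₂ (g k)) , I-induction P base step (proj₂ (proj₂ (g k)))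

ψ-inversion₀ : ∀ R e x → ψ ⟨ ⟨ 0 , e ⟩ , x ⟩ R → x ≡ e
ψ-inversion₀ _ e x (_ , _ , e' , eq , inj₁ (refl , refl))
  with code-injective ⟨ 0 , e ⟩ x ⟨ 0 , e' ⟩ e' eq
... | a≡ , refl = sym (proj₂ (code-injective 0 e 0 e' a≡))
ψ-inversion₀ _ e x (_ , x' , e' , eq , inj₂ (refl , _)) =
  ⊥-elim (0≢1+n (proj₁ (code-injective 0 e 1 e' (proj₁ (code-injective _ x _ x' eq)))))

ψ-inversion₁ : ∀ R e x → ψ ⟨ ⟨ 1 , e ⟩ , x ⟩ R →
               ∃[ t ] ∀ s → φ[ e ] ⟨ t , s ⟩ ∈ (λ v → R ⟨ v , x ⟩)
ψ-inversion₁ _ e x (_ , _ , e' , eq , inj₁ (refl , refl)) =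
  ⊥-elim (0≢1+n (sym (proj₁ (code-injective 1 e 0 e' (proj₁ (code-injective _ x _ e' eq))))))
ψ-inversion₁ _ e x (_ , x' , e' , eq , inj₂ (refl , witness))
  with code-injective ⟨ 1 , e ⟩ x ⟨ 1 , e' ⟩ x' eq
... | a≡ , refl with code-injective 1 e 1 e' a≡
... | _ , refl = witness

Hp⊆closed : (Q : ℕ → Set) → (∀ y → ψ y Q → Q y) → ∀ {a x} → Hp a x → Q ⟨ a , x ⟩
Hp⊆closed Q closed (Hp-0 e) = closed ⟨ ⟨ 0 , e ⟩ , e ⟩ (⟨ 0 , e ⟩ , e , e , refl , inj₁ (refl , refl))
Hp⊆closed Q closed (Hp-1 e x (t , f)) =
  closed ⟨ ⟨ 1 , e ⟩ , x ⟩ (⟨ 1 , e ⟩ , x , e , refl , inj₂ (refl , t , λ s →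
    proj₁ (f s) , proj₁ (proj₂ (f s)) , Hp⊆closed Q closed (proj₂ (proj₂ (f s)))))

consistent⊆Hp : (Q : ℕ → Set) → (∀ y → Q y → ψ y Q) →
                ∀ {a} → I a → ∀ x → Q ⟨ a , x ⟩ → Hp a x
consistent⊆Hp Q consistent = I-induction (λ a → ∀ x → Q ⟨ a , x ⟩ → Hp a x) base step
  where
    base : ∀ e x → Q ⟨ ⟨ 0 , e ⟩ , x ⟩ → Hp ⟨ 0 , e ⟩ x
    base e x q = subst (Hp ⟨ 0 , e ⟩) (sym x≡e) (Hp-0 e)
      where
        x≡e : x ≡ e
        x≡e = ψ-inversion₀ Q e x (consistent ⟨ ⟨ 0 , e ⟩ , x ⟩ q)

    step : ∀ e → (∀ k → φ[ e ] k ∈ (λ a → ∀ x → Q ⟨ a , x ⟩ → Hp a x)) →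
           ∀ x → Q ⟨ ⟨ 1 , e ⟩ , x ⟩ → Hp ⟨ 1 , e ⟩ x
    step e ih x q with ψ-inversion₁ Q e x (consistent ⟨ ⟨ 1 , e ⟩ , x ⟩ q)
    ... | t , witness = Hp-1 e x (t , λ s →
            φ-map (λ (hyp , qv) → hyp x qv) (φ-meet (ih ⟨ t , s ⟩) (witness s)))

lemma14 : (Q : ℕ → Set) → IsFixedPointψ Q →
    ∀ a → I a → ∀ x → (Hp a x → Q ⟨ a , x ⟩) × (Q ⟨ a , x ⟩ → Hp a x)
lemma14 Q fixed a a∈I x =
    Hp⊆closed Q (λ y → proj₂ (fixed y))
  , consistent⊆Hp Q (λ y → proj₁ (fixed y)) a∈I x
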